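{- Let $P_1,\dots,P_m\in\mathbb{F}_q[X_1,\dots,X_n]$ be polynomials of total degree at most $d$, and let $\beta\in\{0,\dots,n\}$. Then the partial sum polynomial $Z_\beta$ has total degree at most $(\min(md,n)-\beta)(q-1)$.
   Context: $q$ is a prime power. Polynomials over $\mathbb{F}_q$ are identified with their reduced representatives in which every variable has individual degree at most $q-1$ (obtained by using $x^q=x$ for $x\in\mathbb{F}_q$). The indicator polynomial is $F\coloneqq\prod_{i=1}^m(1-P_i^{q-1})$ (reduced), and the partial sum polynomial is $Z_\beta(Y_1,\dots,Y_{n-\beta})\coloneqq\sum_{z\in\mathbb{F}_q^\beta}F(Y_1,\dots,Y_{n-\beta},z)$, viewed as a reduced polynomial in $Y_1,\dots,Y_{n-\beta}$. -}

module Defs where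

open import Level using (Level; _⊔_)
open import Algebra.Bundles using (CommutativeRing)
open import Data.Nat as ℕ using (ℕ; zero; suc; _≤_; _∸_)
open import Data.Nat.Primality using (Prime)
open import Data.Nat.Properties using (m∸n+n≡m)
open import Data.Fin using (Fin)
open import Data.Vec as Vec using (Vec; []; _∷_; _++_)
open import Data.List as List using (List; []; _∷_)
open import Data.Product using (Σ; ∃; _×_; _,_)
open import Relation.Nullary using (¬_)
open import Data.Integer as ℤ using (ℤ; +_)
open import Data.List.Relation.Unary.All using (All)
import Data.Vec.Relation.Unary.All as VAll
open import Data.Product using (proj₂)
open import Relation.Binary.PropositionalEquality using (_≡_; subst)

IsPrimePower : ℕ → Set
IsPrimePower q = Σ ℕ λ p → Σ ℕ λ k → Prime p × q ≡ p ℕ.^ suc k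

record FiniteField (c ℓ : Level) (q : ℕ) : Set (Level.suc (c ⊔ ℓ)) where
  field
    commRing : CommutativeRing c ℓ
  open CommutativeRing commRing public
  field
    1≉0     : ¬ (1# ≈ 0#)
    inverse : ∀ x → ¬ (x ≈ 0#) → Σ Carrier λ y → (x * y) ≈ 1#
    enum    : Fin q → Carrier
    enum-injective  : ∀ i j → enum i ≈ enum j → i ≡ j
    enum-surjective : ∀ x → Σ (Fin q) λ i → enum i ≈ x

module _ {c ℓ : Level} {q : ℕ} (K : FiniteField c ℓ q) where
  open FiniteField K

  pow : Carrier → ℕ → Carrier
  pow x zero    = 1#
  pow x (suc e) = x * pow x e

  -- A polynomial in n variables, given as a formal finite sum of terms
  -- (coefficient, exponent vector).  Collecting like terms is not needed:
  -- the statements below only concern the polynomial function / bounds on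
  -- every listed term.
  Poly : ℕ → Set c
  Poly n = List (Carrier × Vec ℕ n)

  evalMono : ∀ {n} → Vec ℕ n → Vec Carrier n → Carrier
  evalMono []       []       = 1#
  evalMono (e ∷ es) (x ∷ xs) = pow x e * evalMono es xs

  eval : ∀ {n} → Poly n → Vec Carrier n → Carrier
  eval []             x = 0#
  eval ((a , e) ∷ ts) x = a * evalMono e x + eval ts x

  mdeg : ∀ {n} → Vec ℕ n → ℕ
  mdeg = Vec.sum

  TotalDegreeAtMost : ∀ {n} → Poly n → ℕ → Set c
  TotalDegreeAtMost P d = All (λ t → mdeg (proj₂ t) ≤ d) P

  -- P is in reduced form (every individual exponent ≤ q-1) and every term
  -- has total degree ≤ D, where D is an integer (D < 0 forces P = 0, the
  -- empty sum, matching deg 0 = -∞).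
  ReducedOfDegreeAtMost : ∀ {n} → Poly n → ℤ → Set c
  ReducedOfDegreeAtMost P D =
    All (λ t → VAll.All (λ e → e ≤ q ∸ 1) (proj₂ t) × (+ mdeg (proj₂ t) ℤ.≤ D)) P

  sumL : List Carrier → Carrier
  sumL = List.foldr _+_ 0#

  prodV : ∀ {m} → Vec Carrier m → Carrier
  prodV = Vec.foldr _ _*_ 1#

  allVecs : (k : ℕ) → List (Vec (Fin q) k)
  allVecs zero    = [] ∷ []
  allVecs (suc k) = List.concatMap (λ i → List.map (i ∷_) (allVecs k)) (List.allFin q)

  points : (k : ℕ) → List (Vec Carrier k)
  points k = List.map (Vec.map enum) (allVecs k)

  indicator : ∀ {m n} → Vec (Poly n) m → Vec Carrier n → Carrier
  indicator Ps x = prodV (Vec.map (λ P → 1# - pow (eval P x) (q ∸ 1)) Ps)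

  partialSum : ∀ {m n} → Vec (Poly n) m → (β : ℕ) → β ≤ n →
               Vec Carrier (n ∸ β) → Carrier
  partialSum {n = n} Ps β β≤n Y =
    sumL (List.map (λ z → indicator Ps (subst (Vec Carrier) (m∸n+n≡m β≤n) (Y ++ z)))
                   (points β))

{-# OPTIONS --safe #-}
-- Expand F = ∏ (1 - Pᵢ^(q-1)) as a polynomial of degree ≤ md(q-1) and reduce its exponents
-- using x^q = x; every exponent is then ≤ q-1, so the degree is also ≤ n(q-1). Summing a
-- reduced monomial Y^a z^b over z ∈ F_q^β gives Y^a ∏ⱼ Σ_{x ∈ F_q} x^(bⱼ), and the power sum
-- Σ_x x^e is 0 for e < q-1 and -1 for e = q-1. So only monomials with every bⱼ = q-1 survive,
-- and each loses exactly β(q-1) from its degree.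
module Submission where

open import Defs
open import Level using (Level)
open import Algebra.Bundles using (Semiring; CommutativeRing; CommutativeMonoid)
import Algebra.Properties.CommutativeMonoid.Sum as CommutativeMonoidSum
import Algebra.Properties.CommutativeSemigroup as CommutativeSemigroupProperties
import Algebra.Properties.Semiring.Exp as SemiringExp
import Algebra.Properties.Group as GroupProperties
import Algebra.Properties.Ring as RingProperties
import Algebra.Properties.AbelianGroup as AbelianGroupProperties
import Algebra.Properties.CommutativeSemiring.Exp as CommutativeSemiringExp
import Algebra.Properties.Semiring.Sum as SemiringSum
open import Data.Nat as ℕ using (ℕ; zero; suc; z≤n; s≤s; _≤_; _∸_; NonZero)
import Data.Nat.Properties as ℕP
open import Data.Nat.DivMod using (_%_; _/_; m≡m%n+[m/n]*n; m%n<n; m%n≤m)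
open import Data.Fin using (Fin; zero; suc; punchIn)
import Data.Fin.Properties as FinP
open import Data.Fin.Permutation using (permutation)
open import Data.List as List using (List; []; _∷_)
import Data.List.Properties as ListP
open import Data.List.Relation.Unary.All as AllAll using (All; []; _∷_)
import Data.List.Relation.Unary.All.Properties as AllP
open import Data.Vec as Vec using (Vec; []; _∷_)
import Data.Vec.Properties as VecP
import Data.Vec.Relation.Unary.All as VAll
import Data.Vec.Relation.Unary.All.Properties as VAllP
open import Data.Product using (Σ; _,_; proj₁; proj₂)
open import Data.Empty using (⊥; ⊥-elim)
open import Data.Integer as ℤ using (+_)
import Data.Integer.Properties as ℤP
open import Relation.Nullary using (¬_; yes; no; ¬?)
import Relation.Nullary.Decidable as Dec
open import Relation.Nullary.Decidable using (_×-dec_)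
open import Relation.Binary.Definitions using (Decidable)
open import Relation.Binary.Core using (_Preserves_⟶_)
open import Function using (_∘_; id)
open import Relation.Binary.PropositionalEquality as ≡ using (_≡_; _≢_)

private
  module ℕ+ = CommutativeSemigroupProperties ℕP.+-commutativeSemigroup

a+n*o≤m*o⇒+a≤[m-n]*o : ∀ {a m n} o .{{_ : NonZero o}} → a ℕ.+ n ℕ.* o ≤ m ℕ.* o →
                        + a ℤ.≤ (+ m ℤ.- + n) ℤ.* + o
a+n*o≤m*o⇒+a≤[m-n]*o {a} {m} {n} o a+no≤mo = ≡.subst (+ a ℤ.≤_) [m∸n]*o≡[m-n]*o (ℤ.+≤+ a≤[m∸n]*o)
  where
  n≤m : n ≤ m
  n≤m = ℕP.*-cancelʳ-≤ n m o (ℕP.≤-trans (ℕP.m≤n+m (n ℕ.* o) a) a+no≤mo)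
  a≤[m∸n]*o : a ≤ (m ∸ n) ℕ.* o
  a≤[m∸n]*o = ≡.subst (a ≤_) (≡.sym (ℕP.*-distribʳ-∸ o m n)) (ℕP.m+n≤o⇒m≤o∸n a a+no≤mo)
  [m∸n]*o≡[m-n]*o : + ((m ∸ n) ℕ.* o) ≡ (+ m ℤ.- + n) ℤ.* + o
  [m∸n]*o≡[m-n]*o = ≡.trans (ℤP.pos-* (m ∸ n) o) (≡.cong (ℤ._* + o) (≡.sym (≡.trans (ℤP.m-n≡m⊖n m n) (ℤP.⊖-≥ n≤m))))

reduceExp : (n : ℕ) .{{_ : NonZero n}} → ℕ → ℕ
reduceExp n zero    = zero
reduceExp n (suc e) = suc (e % n)

reduceExp≤n : ∀ n .{{_ : NonZero n}} e → reduceExp n e ≤ n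
reduceExp≤n n zero    = z≤n
reduceExp≤n n (suc e) = m%n<n e n

reduceExp≤ : ∀ n .{{_ : NonZero n}} e → reduceExp n e ≤ e
reduceExp≤ n zero    = z≤n
reduceExp≤ n (suc e) = s≤s (m%n≤m e n)

module ListSum {c ℓ} (R : Semiring c ℓ) where
  open Semiring R
  open CommutativeSemigroupProperties +-commutativeSemigroup using (interchange)
  open CommutativeMonoidSum +-commutativeMonoid using (sum)

  sumᴸ : List Carrier → Carrier
  sumᴸ = List.foldr _+_ 0#

  sumᴸ-++ : ∀ xs ys → sumᴸ (xs List.++ ys) ≈ sumᴸ xs + sumᴸ ys
  sumᴸ-++ []       ys = sym (+-identityˡ _)
  sumᴸ-++ (x ∷ xs) ys = trans (+-congˡ (sumᴸ-++ xs ys)) (sym (+-assoc _ _ _))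

  sumᴸ-tabulate : ∀ {n} (f : Fin n → Carrier) → sumᴸ (List.tabulate f) ≈ sum f
  sumᴸ-tabulate {zero}  f = refl
  sumᴸ-tabulate {suc n} f = +-congˡ (sumᴸ-tabulate (f ∘ suc))

  sumᴸ-map-allFin : ∀ {n} (f : Fin n → Carrier) → sumᴸ (List.map f (List.allFin n)) ≈ sum f
  sumᴸ-map-allFin f = trans (reflexive (≡.cong sumᴸ (ListP.map-tabulate id f))) (sumᴸ-tabulate f)

  module _ {a} {A : Set a} where

    sumᴸ-map-cong : ∀ xs {f g : A → Carrier} → (∀ x → f x ≈ g x) →
                    sumᴸ (List.map f xs) ≈ sumᴸ (List.map g xs)
    sumᴸ-map-cong []       f≈g = refl
    sumᴸ-map-cong (x ∷ xs) f≈g = +-cong (f≈g x) (sumᴸ-map-cong xs f≈g)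

    sumᴸ-map-0# : ∀ (xs : List A) → sumᴸ (List.map (λ _ → 0#) xs) ≈ 0#
    sumᴸ-map-0# []       = refl
    sumᴸ-map-0# (x ∷ xs) = trans (+-congˡ (sumᴸ-map-0# xs)) (+-identityʳ 0#)

    sumᴸ-map-+ : ∀ xs (f g : A → Carrier) →
                 sumᴸ (List.map (λ x → f x + g x) xs) ≈ sumᴸ (List.map f xs) + sumᴸ (List.map g xs)
    sumᴸ-map-+ []       f g = sym (+-identityˡ 0#)
    sumᴸ-map-+ (x ∷ xs) f g = trans (+-congˡ (sumᴸ-map-+ xs f g)) (interchange _ _ _ _)

    *-distribˡ-sumᴸ-map : ∀ a xs (f : A → Carrier) →
                          a * sumᴸ (List.map f xs) ≈ sumᴸ (List.map (λ x → a * f x) xs)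
    *-distribˡ-sumᴸ-map a []       f = zeroʳ a
    *-distribˡ-sumᴸ-map a (x ∷ xs) f = trans (distribˡ a _ _) (+-congˡ (*-distribˡ-sumᴸ-map a xs f))

  sumᴸ-map-concatMap : ∀ {a b} {A : Set a} {B : Set b} (g : B → Carrier) (h : A → List B) xs →
                       sumᴸ (List.map g (List.concatMap h xs)) ≈ sumᴸ (List.map (λ x → sumᴸ (List.map g (h x))) xs)
  sumᴸ-map-concatMap g h []       = refl
  sumᴸ-map-concatMap g h (x ∷ xs) = begin
    sumᴸ (List.map g (h x List.++ List.concatMap h xs))
      ≡⟨ ≡.cong sumᴸ (ListP.map-++ g (h x) _) ⟩
    sumᴸ (List.map g (h x) List.++ List.map g (List.concatMap h xs))
      ≈⟨ sumᴸ-++ (List.map g (h x)) _ ⟩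
    sumᴸ (List.map g (h x)) + sumᴸ (List.map g (List.concatMap h xs))
      ≈⟨ +-congˡ (sumᴸ-map-concatMap g h xs) ⟩
    sumᴸ (List.map (λ y → sumᴸ (List.map g (h y))) (x ∷ xs)) ∎
    where open import Relation.Binary.Reasoning.Setoid setoid

module _ {c ℓ} (R : Semiring c ℓ) where
  open Semiring R
  open SemiringExp R
  open import Relation.Binary.Reasoning.Setoid setoid

  module _ {x : Carrier} {n : ℕ} (x^[1+n]≈x : x ^ suc n ≈ x) where

    ^-absorb : ∀ m → x ^ (n ℕ.+ suc m) ≈ x ^ suc m
    ^-absorb m = begin
      x ^ (n ℕ.+ suc m)  ≡⟨ ≡.cong (x ^_) (ℕP.+-suc n m) ⟩
      x ^ (suc n ℕ.+ m)  ≈⟨ ^-homo-* x (suc n) m ⟩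
      x ^ suc n * x ^ m  ≈⟨ *-congʳ x^[1+n]≈x ⟩
      x * x ^ m          ∎

    ^-periodic : ∀ a k → x ^ suc (a ℕ.+ k ℕ.* n) ≈ x ^ suc a
    ^-periodic a zero    = ^-congʳ x (≡.cong suc (ℕP.+-identityʳ a))
    ^-periodic a (suc k) = begin
      x ^ suc (a ℕ.+ (n ℕ.+ k ℕ.* n))  ≡⟨ ≡.cong (x ^_) (ℕ+.x∙yz≈y∙xz (suc a) n (k ℕ.* n)) ⟩
      x ^ (n ℕ.+ suc (a ℕ.+ k ℕ.* n))  ≈⟨ ^-absorb _ ⟩
      x ^ suc (a ℕ.+ k ℕ.* n)           ≈⟨ ^-periodic a k ⟩
      x ^ suc a                         ∎

    ^-reduceExp : .{{_ : NonZero n}} → ∀ e → x ^ reduceExp n e ≈ x ^ e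
    ^-reduceExp zero    = refl
    ^-reduceExp (suc e) = sym (begin
      x ^ suc e                          ≡⟨ ≡.cong (λ m → x ^ suc m) (m≡m%n+[m/n]*n e n) ⟩
      x ^ suc (e % n ℕ.+ (e / n) ℕ.* n)  ≈⟨ ^-periodic (e % n) (e / n) ⟩
      x ^ suc (e % n)                    ∎)

module MonicRootBound {c ℓ} (R : CommutativeRing c ℓ) where
  open CommutativeRing R hiding (zero)

  open SemiringExp semiring using (_^_)
  open GroupProperties +-group using (x∙y⁻¹≈ε⇒x≈y)
  open CommutativeSemigroupProperties +-commutativeSemigroup using (x∙yz≈y∙xz)
  open CommutativeSemigroupProperties *-commutativeSemigroup using () renaming (x∙yz≈y∙xz to x*yz≈y*xz)
  open import Relation.Binary.Reasoning.Setoid setoid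

  -- e coefficients a₀ … aₑ₋₁ encode the monic polynomial a₀ + a₁ X + … + aₑ₋₁ Xᵉ⁻¹ + Xᵉ.
  evalMonic : ∀ {e} → Vec Carrier e → Carrier → Carrier
  evalMonic []       x = 1#
  evalMonic (a ∷ as) x = a + x * evalMonic as x

  divideByRoot : ∀ {e} → Vec Carrier (suc e) → Carrier → Vec Carrier e
  divideByRoot (_ ∷ [])     a = []
  divideByRoot (_ ∷ b ∷ bs) a = evalMonic (b ∷ bs) a ∷ divideByRoot (b ∷ bs) a

  private
    *-split : ∀ x a w → x * w ≈ a * w + (x - a) * w
    *-split x a w = begin
      x * w                ≈⟨ *-congʳ (sym a+[x-a]≈x) ⟩
      (a + (x - a)) * w    ≈⟨ distribʳ w a (x - a) ⟩
      a * w + (x - a) * w  ∎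
      where
      a+[x-a]≈x : a + (x - a) ≈ x
      a+[x-a]≈x = trans (x∙yz≈y∙xz a x (- a)) (trans (+-congˡ (-‿inverseʳ a)) (+-identityʳ x))

  evalMonic-divideByRoot : ∀ {e} (p : Vec Carrier (suc e)) x a →
    evalMonic p x ≈ evalMonic p a + (x - a) * evalMonic (divideByRoot p a) x
  evalMonic-divideByRoot (b ∷ []) x a = begin
    b + x * 1#                     ≈⟨ +-congˡ (*-split x a 1#) ⟩
    b + (a * 1# + (x - a) * 1#)    ≈⟨ sym (+-assoc b _ _) ⟩
    (b + a * 1#) + (x - a) * 1#    ∎
  evalMonic-divideByRoot (b ∷ b′ ∷ bs) x a = begin
    b + x * u                                  ≈⟨ +-congˡ (*-congˡ (evalMonic-divideByRoot (b′ ∷ bs) x a)) ⟩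
    b + x * (w + (x - a) * g)                  ≈⟨ +-congˡ (distribˡ x w _) ⟩
    b + (x * w + x * ((x - a) * g))            ≈⟨ +-congˡ (+-cong (*-split x a w) (x*yz≈y*xz x (x - a) g)) ⟩
    b + ((a * w + (x - a) * w) + (x - a) * (x * g))  ≈⟨ trans (+-congˡ (+-assoc _ _ _)) (sym (+-assoc b _ _)) ⟩
    (b + a * w) + ((x - a) * w + (x - a) * (x * g))  ≈⟨ +-congˡ (sym (distribˡ (x - a) w (x * g))) ⟩
    (b + a * w) + (x - a) * (w + x * g)        ∎
    where
    u = evalMonic (b′ ∷ bs) x
    w = evalMonic (b′ ∷ bs) a
    g = evalMonic (divideByRoot (b′ ∷ bs) a) x

  evalMonic-replicate-0# : ∀ k x → evalMonic (Vec.replicate k 0#) x ≈ x ^ k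
  evalMonic-replicate-0# zero    x = refl
  evalMonic-replicate-0# (suc k) x = trans (+-identityˡ _) (*-congˡ (evalMonic-replicate-0# k x))

  X^[1+e]-1 : ∀ e → Vec Carrier (suc e)
  X^[1+e]-1 e = - 1# ∷ Vec.replicate e 0#

  evalMonic-X^[1+e]-1 : ∀ e x → x ^ suc e ≈ 1# → evalMonic (X^[1+e]-1 e) x ≈ 0#
  evalMonic-X^[1+e]-1 e x x^[1+e]≈1 =
    trans (+-congˡ (trans (*-congˡ (evalMonic-replicate-0# e x)) x^[1+e]≈1)) (-‿inverseˡ 1#)

  module _ (1≉0 : ¬ 1# ≈ 0#) (*-cancelˡ-0 : ∀ {x y} → ¬ x ≈ 0# → x * y ≈ 0# → y ≈ 0#) where

    distinctRoots≤degree : ∀ {e n} (p : Vec Carrier e) (r : Fin n → Carrier) →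
      (∀ i j → r i ≈ r j → i ≡ j) → (∀ i → evalMonic p (r i) ≈ 0#) → n ≤ e
    distinctRoots≤degree {n = zero}  p       r _   _    = z≤n
    distinctRoots≤degree {n = suc n} []      r _   root = ⊥-elim (1≉0 (root zero))
    distinctRoots≤degree {n = suc n} (b ∷ p) r inj root =
      s≤s (distinctRoots≤degree (divideByRoot (b ∷ p) a) (r ∘ suc) inj′ root′)
      where
      a = r zero
      inj′ : ∀ i j → r (suc i) ≈ r (suc j) → i ≡ j
      inj′ i j = FinP.suc-injective ∘ inj (suc i) (suc j)
      root′ : ∀ i → evalMonic (divideByRoot (b ∷ p) a) (r (suc i)) ≈ 0#
      root′ i = *-cancelˡ-0 (λ x-a≈0 → FinP.0≢1+n (≡.sym (inj (suc i) zero (x∙y⁻¹≈ε⇒x≈y _ _ x-a≈0)))) (begin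
        (x - a) * evalMonic (divideByRoot (b ∷ p) a) x       ≈⟨ +-identityˡ _ ⟨
        0# + (x - a) * evalMonic (divideByRoot (b ∷ p) a) x  ≈⟨ +-congʳ (root zero) ⟨
        evalMonic (b ∷ p) a + _                               ≈⟨ evalMonic-divideByRoot (b ∷ p) x a ⟨
        evalMonic (b ∷ p) x                                   ≈⟨ root (suc i) ⟩
        0#                                                    ∎)
        where x = r (suc i)

module FiniteFieldProperties {c ℓ n} (K : FiniteField c ℓ (suc n)) where
  open FiniteField K hiding (zero)
  open SemiringExp semiring using (_^_)
  open RingProperties ring using ([y-z]x≈yx-zx)
  open GroupProperties +-group using (identityʳ-unique; x∙y⁻¹≈ε⇒x≈y; //-rightDividesˡ; //-rightDividesʳ)
  open import Relation.Binary.Reasoning.Setoid setoid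

  index : Carrier → Fin (suc n)
  index x = proj₁ (enum-surjective x)

  enum-index : ∀ x → enum (index x) ≈ x
  enum-index x = proj₂ (enum-surjective x)

  index-cong : ∀ {x y} → x ≈ y → index x ≡ index y
  index-cong {x} {y} x≈y = enum-injective _ _ (trans (enum-index x) (trans x≈y (sym (enum-index y))))

  index-enum : ∀ i → index (enum i) ≡ i
  index-enum i = enum-injective _ _ (enum-index (enum i))

  infix 4 _≟_
  _≟_ : Decidable _≈_
  x ≟ y = Dec.map′ index≡⇒≈ index-cong (index x FinP.≟ index y)
    where
    index≡⇒≈ : index x ≡ index y → x ≈ y
    index≡⇒≈ eq = trans (sym (enum-index x)) (trans (reflexive (≡.cong enum eq)) (enum-index y))

  enum-≉0 : ∀ {i} → i ≢ index 0# → ¬ enum i ≈ 0#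
  enum-≉0 {i} i≢i₀ eᵢ≈0 = i≢i₀ (≡.trans (≡.sym (index-enum i)) (index-cong eᵢ≈0))

  *-cancelʳ : ∀ {x y z} → ¬ z ≈ 0# → x * z ≈ y * z → x ≈ y
  *-cancelʳ {x} {y} {z} z≉0 xz≈yz = begin
    x               ≈⟨ *-identityʳ x ⟨
    x * 1#          ≈⟨ *-congˡ zz⁻¹≈1 ⟨
    x * (z * z⁻¹)   ≈⟨ *-assoc x z z⁻¹ ⟨
    (x * z) * z⁻¹   ≈⟨ *-congʳ xz≈yz ⟩
    (y * z) * z⁻¹   ≈⟨ *-assoc y z z⁻¹ ⟩
    y * (z * z⁻¹)   ≈⟨ *-congˡ zz⁻¹≈1 ⟩
    y * 1#          ≈⟨ *-identityʳ y ⟩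
    y               ∎
    where
    z⁻¹ = proj₁ (inverse z z≉0)
    zz⁻¹≈1 = proj₂ (inverse z z≉0)

  *-cancelˡ-0 : ∀ {x y} → ¬ x ≈ 0# → x * y ≈ 0# → y ≈ 0#
  *-cancelˡ-0 {x} {y} x≉0 xy≈0 = *-cancelʳ x≉0 (trans (*-comm y x) (trans xy≈0 (sym (zeroˡ x))))

  x*y≈y⇒y≈0 : ∀ {x y} → ¬ x ≈ 1# → x * y ≈ y → y ≈ 0#
  x*y≈y⇒y≈0 {x} {y} x≉1 xy≈y = *-cancelˡ-0 (λ x-1≈0 → x≉1 (x∙y⁻¹≈ε⇒x≈y x 1# x-1≈0)) (begin
    (x - 1#) * y     ≈⟨ [y-z]x≈yx-zx y x 1# ⟩
    x * y - 1# * y   ≈⟨ +-cong xy≈y (-‿cong (*-identityˡ y)) ⟩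
    y - y            ≈⟨ -‿inverseʳ y ⟩
    0#               ∎)

  module Summation {m ℓm} (M : CommutativeMonoid m ℓm) where
    private module M = CommutativeMonoid M
    open CommutativeMonoidSum M using (sum; sum-cong-≋; sum-permute; sum-remove; sum-replicate; ∑-distrib-+)
    open import Algebra.Definitions.RawMonoid M.rawMonoid using (_×_)

    ∑ : (Carrier → M.Carrier) → M.Carrier
    ∑ f = sum (λ i → f (enum i))

    ∑-cong : ∀ {f g : Carrier → M.Carrier} → (∀ x → f x M.≈ g x) → ∑ f M.≈ ∑ g
    ∑-cong f≈g = sum-cong-≋ (λ i → f≈g (enum i))

    ∑-∙ : ∀ (f g : Carrier → M.Carrier) → ∑ (λ x → f x M.∙ g x) M.≈ ∑ f M.∙ ∑ g
    ∑-∙ f g = ∑-distrib-+ (f ∘ enum) (g ∘ enum)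

    module _ {f : Carrier → M.Carrier} (f-cong : f Preserves _≈_ ⟶ M._≈_) where

      ∑-bijection : ∀ (σ σ⁻¹ : Carrier → Carrier) → σ Preserves _≈_ ⟶ _≈_ → σ⁻¹ Preserves _≈_ ⟶ _≈_ →
                    (∀ x → σ (σ⁻¹ x) ≈ x) → (∀ x → σ⁻¹ (σ x) ≈ x) → ∑ (f ∘ σ) M.≈ ∑ f
      ∑-bijection σ σ⁻¹ σ-cong σ⁻¹-cong σσ⁻¹ σ⁻¹σ = M.sym (M.trans (sum-permute (f ∘ enum) π)
        (sum-cong-≋ (λ i → f-cong (enum-index (σ (enum i))))))
        where
        π = permutation (λ i → index (σ (enum i))) (λ j → index (σ⁻¹ (enum j)))
              (λ j → ≡.trans (index-cong (trans (σ-cong (enum-index _)) (σσ⁻¹ _))) (index-enum j))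
              (λ i → ≡.trans (index-cong (trans (σ⁻¹-cong (enum-index _)) (σ⁻¹σ _))) (index-enum i))

      ∑-translate : ∀ b → ∑ (λ x → f (x + b)) M.≈ ∑ f
      ∑-translate b = ∑-bijection (_+ b) (_- b) +-congʳ +-congʳ (//-rightDividesˡ b) (//-rightDividesʳ b)

      ∑-scale : ∀ {a} → ¬ a ≈ 0# → ∑ (λ x → f (a * x)) M.≈ ∑ f
      ∑-scale {a} a≉0 = ∑-bijection (a *_) (a⁻¹ *_) *-congˡ *-congˡ (cancel a a⁻¹ aa⁻¹≈1) (cancel a⁻¹ a a⁻¹a≈1)
        where
        a⁻¹ = proj₁ (inverse a a≉0)
        aa⁻¹≈1 = proj₂ (inverse a a≉0)
        a⁻¹a≈1 = trans (*-comm a⁻¹ a) aa⁻¹≈1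
        cancel : ∀ b b′ → b * b′ ≈ 1# → ∀ x → b * (b′ * x) ≈ x
        cancel b b′ bb′≈1 x = trans (sym (*-assoc b b′ x)) (trans (*-congʳ bb′≈1) (*-identityˡ x))

      ∑-split-0# : ∀ {v} → (∀ x → ¬ x ≈ 0# → f x M.≈ v) → ∑ f M.≈ f 0# M.∙ n × v
      ∑-split-0# {v} f≈v = M.trans (sum-remove {i = index 0#} (f ∘ enum))
        (M.∙-cong (f-cong (enum-index 0#))
                  (M.trans (sum-cong-≋ (λ j → f≈v _ (enum-≉0 (FinP.punchInᵢ≢i _ j)))) (sum-replicate n)))

  module ∑ = Summation +-commutativeMonoid
  module ∏ = Summation *-commutativeMonoid

  open ∑ using (∑)
  open CommutativeMonoidSum +-commutativeMonoid using (sum-replicate)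
  open CommutativeMonoidSum *-commutativeMonoid using () renaming (sum to product)
  open import Algebra.Definitions.RawMonoid +-rawMonoid using (_×_)

  characteristic : suc n × 1# ≈ 0#
  characteristic = identityʳ-unique (∑ id) _ (begin
    ∑ id + suc n × 1#      ≈⟨ +-congˡ (sum-replicate (suc n)) ⟨
    ∑ id + ∑ (λ _ → 1#)    ≈⟨ ∑.∑-∙ id (λ _ → 1#) ⟨
    ∑ (λ x → x + 1#)       ≈⟨ ∑.∑-translate id 1# ⟩
    ∑ id                   ∎)

  caseZero : Carrier → Carrier → Carrier → Carrier
  caseZero x y z with x ≟ 0#
  ... | yes _ = y
  ... | no  _ = z

  caseZero-≈0 : ∀ {x y z} → x ≈ 0# → caseZero x y z ≈ y
  caseZero-≈0 {x} x≈0 with x ≟ 0#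
  ... | yes _   = refl
  ... | no  x≉0 = ⊥-elim (x≉0 x≈0)

  caseZero-≉0 : ∀ {x y z} → ¬ x ≈ 0# → caseZero x y z ≈ z
  caseZero-≉0 {x} x≉0 with x ≟ 0#
  ... | yes x≈0 = ⊥-elim (x≉0 x≈0)
  ... | no  _   = refl

  caseZero-cong : ∀ {x x′ y y′ z z′} → x ≈ x′ → y ≈ y′ → z ≈ z′ → caseZero x y z ≈ caseZero x′ y′ z′
  caseZero-cong {x} {x′} x≈x′ y≈y′ z≈z′ with x ≟ 0#
  ... | yes x≈0 = trans y≈y′ (sym (caseZero-≈0 (trans (sym x≈x′) x≈0)))
  ... | no  x≉0 = trans z≈z′ (sym (caseZero-≉0 (λ x′≈0 → x≉0 (trans x≈x′ x′≈0))))

  unitPart : Carrier → Carrier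
  unitPart x = caseZero x 1# x

  unitPart-≉0 : ∀ x → ¬ unitPart x ≈ 0#
  unitPart-≉0 x with x ≟ 0#
  ... | yes _   = 1≉0
  ... | no  x≉0 = x≉0

  unitPart-* : ∀ {a} → ¬ a ≈ 0# → ∀ x → unitPart (a * x) ≈ caseZero x 1# a * unitPart x
  unitPart-* {a} a≉0 x with x ≟ 0#
  ... | yes x≈0 = trans (caseZero-≈0 (trans (*-congˡ x≈0) (zeroʳ a))) (sym (*-identityˡ 1#))
  ... | no  x≉0 = caseZero-≉0 (λ ax≈0 → x≉0 (*-cancelˡ-0 a≉0 ax≈0))

  product-≉0 : ∀ {k} (f : Fin k → Carrier) → (∀ i → ¬ f i ≈ 0#) → ¬ product f ≈ 0#
  product-≉0 {zero}  f f≉0 = 1≉0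
  product-≉0 {suc k} f f≉0 ∏f≈0 = product-≉0 (f ∘ suc) (f≉0 ∘ suc) (*-cancelˡ-0 (f≉0 zero) ∏f≈0)

  -- x ↦ a x permutes the field, and it scales unitPart x by a exactly when x ≠ 0
  fermat : ∀ {a} → ¬ a ≈ 0# → a ^ n ≈ 1#
  fermat {a} a≉0 = *-cancelʳ (product-≉0 _ (unitPart-≉0 ∘ enum)) (begin
    a ^ n * ∏.∑ unitPart                        ≈⟨ *-congʳ ∏-caseZero ⟨
    ∏.∑ (λ x → caseZero x 1# a) * ∏.∑ unitPart  ≈⟨ ∏.∑-∙ (λ x → caseZero x 1# a) unitPart ⟨
    ∏.∑ (λ x → caseZero x 1# a * unitPart x)    ≈⟨ ∏.∑-cong (unitPart-* a≉0) ⟨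
    ∏.∑ (λ x → unitPart (a * x))                ≈⟨ ∏.∑-scale (λ x≈y → caseZero-cong x≈y refl x≈y) a≉0 ⟩
    ∏.∑ unitPart                                ≈⟨ *-identityˡ _ ⟨
    1# * ∏.∑ unitPart                           ∎)
    where
    ∏-caseZero : ∏.∑ (λ x → caseZero x 1# a) ≈ a ^ n
    ∏-caseZero = begin
      ∏.∑ (λ x → caseZero x 1# a)  ≈⟨ ∏.∑-split-0# (λ x≈y → caseZero-cong x≈y refl refl) (λ _ → caseZero-≉0) ⟩
      caseZero 0# 1# a * a ^ n     ≈⟨ *-congʳ (caseZero-≈0 refl) ⟩
      1# * a ^ n                   ≈⟨ *-identityˡ _ ⟩
      a ^ n                        ∎

  x^[1+n]≈x : ∀ x → x ^ suc n ≈ x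
  x^[1+n]≈x x with x ≟ 0#
  ... | yes x≈0 = trans (*-congʳ x≈0) (trans (zeroˡ _) (sym x≈0))
  ... | no  x≉0 = trans (*-congˡ (fermat x≉0)) (*-identityʳ x)

module PowerSums {c ℓ r} (K : FiniteField c ℓ (suc (suc r))) where
  open FiniteField K hiding (zero)
  open FiniteFieldProperties K
  open MonicRootBound commRing using (evalMonic; distinctRoots≤degree; X^[1+e]-1; evalMonic-X^[1+e]-1)
  open SemiringExp semiring using (_^_; ^-congˡ)
  open CommutativeSemiringExp commutativeSemiring using (^-distrib-*)
  open SemiringSum semiring using (*-distribˡ-sum; sum-replicate)
  open import Algebra.Definitions.RawMonoid +-rawMonoid using (_×_)
  open GroupProperties +-group using (inverseʳ-unique)
  open ∑ using (∑)
  open import Relation.Binary.Reasoning.Setoid setoid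

  q-1 : ℕ
  q-1 = suc r

  powerSum : ℕ → Carrier
  powerSum e = ∑ (_^ e)

  powerSum-q-1 : powerSum q-1 ≈ - 1#
  powerSum-q-1 = begin
    ∑ (_^ q-1)            ≈⟨ ∑.∑-split-0# (^-congˡ q-1) (λ _ → fermat) ⟩
    0# ^ q-1 + q-1 × 1#   ≈⟨ +-congʳ (zeroˡ _) ⟩
    0# + q-1 × 1#         ≈⟨ +-identityˡ _ ⟩
    q-1 × 1#              ≈⟨ inverseʳ-unique 1# _ characteristic ⟩
    - 1#                  ∎

  -- Since Xᵉ - 1 has at most e < q - 1 roots, some unit a has aᵉ ≠ 1, and aᵉ S = S forces S = 0.
  powerSum-< : ∀ {e} → e ℕ.< q-1 → powerSum e ≈ 0#
  powerSum-< {zero}   _     = trans (sum-replicate (suc (suc r))) characteristic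
  powerSum-< {suc e} e<q-1 with FinP.any? (λ i → ¬? (enum i ≟ 0#) ×-dec ¬? (enum i ^ suc e ≟ 1#))
  ... | yes (i , a≉0 , aᵉ≉1) = x*y≈y⇒y≈0 aᵉ≉1 (begin
    a ^ suc e * ∑ (_^ suc e)        ≈⟨ *-distribˡ-sum (a ^ suc e) (λ i → enum i ^ suc e) ⟩
    ∑ (λ x → a ^ suc e * x ^ suc e) ≈⟨ ∑.∑-cong (λ x → ^-distrib-* a x (suc e)) ⟨
    ∑ (λ x → (a * x) ^ suc e)       ≈⟨ ∑.∑-scale (^-congˡ (suc e)) a≉0 ⟩
    ∑ (_^ suc e)                    ∎)
    where a = enum i
  ... | no ∄a = ⊥-elim (ℕP.<⇒≱ e<q-1 (distinctRoots≤degree 1≉0 *-cancelˡ-0 (X^[1+e]-1 e) units units-injective units-roots))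
    where
    units : Fin q-1 → Carrier
    units j = enum (punchIn (index 0#) j)
    units-injective : ∀ i j → units i ≈ units j → i ≡ j
    units-injective i j = FinP.punchIn-injective _ i j ∘ enum-injective _ _
    units-roots : ∀ j → evalMonic (X^[1+e]-1 e) (units j) ≈ 0#
    units-roots j = evalMonic-X^[1+e]-1 e (units j) (Dec.decidable-stable (units j ^ suc e ≟ 1#)
      (λ uʲ≉1 → ∄a (punchIn (index 0#) j , enum-≉0 (FinP.punchInᵢ≢i _ j) , uʲ≉1)))

module Polynomials {c ℓ q} (K : FiniteField c ℓ q) where
  open FiniteField K hiding (zero)
  open SemiringExp semiring using (_^_; ^-homo-*)
  open CommutativeSemigroupProperties *-commutativeSemigroup using () renaming (interchange to *-interchange)
  open GroupProperties +-group using (ε⁻¹≈ε)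
  open AbelianGroupProperties +-abelianGroup using (⁻¹-∙-comm)
  open RingProperties ring using (-‿distribˡ-*)
  open import Data.Product using (_×_)
  open import Relation.Binary.Reasoning.Setoid setoid

  Term : ℕ → Set c
  Term n = Carrier × Vec ℕ n

  mdeg-zipWith-+ : ∀ {n} (e f : Vec ℕ n) → mdeg K (Vec.zipWith ℕ._+_ e f) ≡ mdeg K e ℕ.+ mdeg K f
  mdeg-zipWith-+ []      []      = ≡.refl
  mdeg-zipWith-+ (a ∷ e) (b ∷ f) = ≡.trans (≡.cong (a ℕ.+ b ℕ.+_) (mdeg-zipWith-+ e f)) (ℕ+.interchange a b _ _)

  mdeg-replicate : ∀ n a → mdeg K (Vec.replicate n a) ≡ n ℕ.* a
  mdeg-replicate zero    a = ≡.refl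
  mdeg-replicate (suc n) a = ≡.cong (a ℕ.+_) (mdeg-replicate n a)

  mdeg-++-replicate : ∀ {k} (e : Vec ℕ k) n a → mdeg K (e Vec.++ Vec.replicate n a) ≡ mdeg K e ℕ.+ n ℕ.* a
  mdeg-++-replicate e n a = ≡.trans (VecP.sum-++ e) (≡.cong (mdeg K e ℕ.+_) (mdeg-replicate n a))

  pow≡^ : ∀ x e → pow K x e ≡ x ^ e
  pow≡^ x zero    = ≡.refl
  pow≡^ x (suc e) = ≡.cong (x *_) (pow≡^ x e)

  pow-+ : ∀ x a b → pow K x (a ℕ.+ b) ≈ pow K x a * pow K x b
  pow-+ x a b rewrite pow≡^ x (a ℕ.+ b) | pow≡^ x a | pow≡^ x b = ^-homo-* x a b

  evalMono-replicate-0 : ∀ {n} (x : Vec Carrier n) → evalMono K (Vec.replicate n 0) x ≈ 1#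
  evalMono-replicate-0 []       = refl
  evalMono-replicate-0 (x ∷ xs) = trans (*-identityˡ _) (evalMono-replicate-0 xs)

  evalMono-zipWith-+ : ∀ {n} (e f : Vec ℕ n) x →
    evalMono K (Vec.zipWith ℕ._+_ e f) x ≈ evalMono K e x * evalMono K f x
  evalMono-zipWith-+ []      []      []       = sym (*-identityˡ 1#)
  evalMono-zipWith-+ (a ∷ e) (b ∷ f) (x ∷ xs) = begin
    pow K x (a ℕ.+ b) * evalMono K (Vec.zipWith ℕ._+_ e f) xs
      ≈⟨ *-cong (pow-+ x a b) (evalMono-zipWith-+ e f xs) ⟩
    (pow K x a * pow K x b) * (evalMono K e xs * evalMono K f xs)
      ≈⟨ *-interchange _ _ _ _ ⟩
    (pow K x a * evalMono K e xs) * (pow K x b * evalMono K f xs) ∎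

  evalMono-++ : ∀ {k β} (e : Vec ℕ k) (f : Vec ℕ β) Y z →
    evalMono K (e Vec.++ f) (Y Vec.++ z) ≈ evalMono K e Y * evalMono K f z
  evalMono-++ []      f []      z = sym (*-identityˡ _)
  evalMono-++ (a ∷ e) f (y ∷ Y) z = trans (*-congˡ (evalMono-++ e f Y z)) (sym (*-assoc _ _ _))

  1ₚ : ∀ {n} → Poly K n
  1ₚ = (1# , Vec.replicate _ 0) ∷ []

  -ₚ_ : ∀ {n} → Poly K n → Poly K n
  -ₚ_ = List.map (λ (a , e) → (- a , e))

  _*ₜ_ : ∀ {n} → Term n → Poly K n → Poly K n
  (a , e) *ₜ P = List.map (λ (b , f) → (a * b , Vec.zipWith ℕ._+_ e f)) P

  _*ₚ_ : ∀ {n} → Poly K n → Poly K n → Poly K n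
  P *ₚ Q = List.concatMap (_*ₜ Q) P

  _^ₚ_ : ∀ {n} → Poly K n → ℕ → Poly K n
  P ^ₚ zero  = 1ₚ
  P ^ₚ suc k = P *ₚ (P ^ₚ k)

  indicatorPoly : ∀ {m n} → Vec (Poly K n) m → Poly K n
  indicatorPoly []       = 1ₚ
  indicatorPoly (P ∷ Ps) = (1ₚ List.++ -ₚ (P ^ₚ (q ∸ 1))) *ₚ indicatorPoly Ps

  eval-++ : ∀ {n} (P Q : Poly K n) x → eval K (P List.++ Q) x ≈ eval K P x + eval K Q x
  eval-++ []      Q x = sym (+-identityˡ _)
  eval-++ (t ∷ P) Q x = trans (+-congˡ (eval-++ P Q x)) (sym (+-assoc _ _ _))

  eval-1ₚ : ∀ {n} (x : Vec Carrier n) → eval K 1ₚ x ≈ 1#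
  eval-1ₚ x = trans (+-identityʳ _) (trans (*-identityˡ _) (evalMono-replicate-0 x))

  eval-negₚ : ∀ {n} (P : Poly K n) x → eval K (-ₚ P) x ≈ - eval K P x
  eval-negₚ []            x = sym ε⁻¹≈ε
  eval-negₚ ((a , e) ∷ P) x = begin
    - a * evalMono K e x + eval K (-ₚ P) x   ≈⟨ +-cong (sym (-‿distribˡ-* a _)) (eval-negₚ P x) ⟩
    - (a * evalMono K e x) + - eval K P x    ≈⟨ ⁻¹-∙-comm _ _ ⟩
    - (a * evalMono K e x + eval K P x)      ∎

  eval-*ₜ : ∀ {n} (t : Term n) (P : Poly K n) x →
    eval K (t *ₜ P) x ≈ (proj₁ t * evalMono K (proj₂ t) x) * eval K P x
  eval-*ₜ t             []            x = sym (zeroʳ _)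
  eval-*ₜ (a , e) ((b , f) ∷ P) x = begin
    a * b * evalMono K (Vec.zipWith ℕ._+_ e f) x + eval K ((a , e) *ₜ P) x
      ≈⟨ +-cong (*-congˡ (evalMono-zipWith-+ e f x)) (eval-*ₜ (a , e) P x) ⟩
    a * b * (evalMono K e x * evalMono K f x) + a * evalMono K e x * eval K P x
      ≈⟨ +-congʳ (*-interchange a b _ _) ⟩
    a * evalMono K e x * (b * evalMono K f x) + a * evalMono K e x * eval K P x
      ≈⟨ distribˡ _ _ _ ⟨
    a * evalMono K e x * (b * evalMono K f x + eval K P x) ∎

  eval-*ₚ : ∀ {n} (P Q : Poly K n) x → eval K (P *ₚ Q) x ≈ eval K P x * eval K Q x
  eval-*ₚ []      Q x = sym (zeroˡ _)
  eval-*ₚ (t ∷ P) Q x = begin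
    eval K (t *ₜ Q List.++ P *ₚ Q) x                                   ≈⟨ eval-++ (t *ₜ Q) (P *ₚ Q) x ⟩
    eval K (t *ₜ Q) x + eval K (P *ₚ Q) x                              ≈⟨ +-cong (eval-*ₜ t Q x) (eval-*ₚ P Q x) ⟩
    proj₁ t * evalMono K (proj₂ t) x * eval K Q x + eval K P x * eval K Q x  ≈⟨ distribʳ _ _ _ ⟨
    (proj₁ t * evalMono K (proj₂ t) x + eval K P x) * eval K Q x      ∎

  eval-^ₚ : ∀ {n} (P : Poly K n) k x → eval K (P ^ₚ k) x ≈ pow K (eval K P x) k
  eval-^ₚ P zero    x = eval-1ₚ x
  eval-^ₚ P (suc k) x = trans (eval-*ₚ P (P ^ₚ k) x) (*-congˡ (eval-^ₚ P k x))

  eval-indicatorPoly : ∀ {m n} (Ps : Vec (Poly K n) m) x → eval K (indicatorPoly Ps) x ≈ indicator K Ps x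
  eval-indicatorPoly []       x = eval-1ₚ x
  eval-indicatorPoly (P ∷ Ps) x = begin
    eval K ((1ₚ List.++ -ₚ (P ^ₚ (q ∸ 1))) *ₚ indicatorPoly Ps) x
      ≈⟨ eval-*ₚ (1ₚ List.++ -ₚ (P ^ₚ (q ∸ 1))) (indicatorPoly Ps) x ⟩
    eval K (1ₚ List.++ -ₚ (P ^ₚ (q ∸ 1))) x * eval K (indicatorPoly Ps) x
      ≈⟨ *-cong (eval-++ 1ₚ (-ₚ (P ^ₚ (q ∸ 1))) x) (eval-indicatorPoly Ps x) ⟩
    (eval K 1ₚ x + eval K (-ₚ (P ^ₚ (q ∸ 1))) x) * indicator K Ps x
      ≈⟨ *-congʳ (+-cong (eval-1ₚ x) (trans (eval-negₚ (P ^ₚ (q ∸ 1)) x) (-‿cong (eval-^ₚ P (q ∸ 1) x)))) ⟩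
    (1# - pow K (eval K P x) (q ∸ 1)) * indicator K Ps x ∎

  degree-1ₚ : ∀ {n} d → TotalDegreeAtMost K (1ₚ {n}) d
  degree-1ₚ {n} d = ≡.subst (_≤ d) (≡.sym (≡.trans (mdeg-replicate n 0) (ℕP.*-zeroʳ n))) z≤n ∷ []

  degree-negₚ : ∀ {n d} {P : Poly K n} → TotalDegreeAtMost K P d → TotalDegreeAtMost K (-ₚ P) d
  degree-negₚ = AllP.map⁺

  degree-*ₜ : ∀ {n d₁ d₂} (t : Term n) (P : Poly K n) → mdeg K (proj₂ t) ≤ d₁ →
              TotalDegreeAtMost K P d₂ → TotalDegreeAtMost K (t *ₜ P) (d₁ ℕ.+ d₂)
  degree-*ₜ t       []            _   []          = []
  degree-*ₜ (a , e) ((b , f) ∷ P) e≤d (f≤d ∷ P≤d) =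
    ≡.subst (_≤ _) (≡.sym (mdeg-zipWith-+ e f)) (ℕP.+-mono-≤ e≤d f≤d) ∷ degree-*ₜ (a , e) P e≤d P≤d

  degree-*ₚ : ∀ {n d₁ d₂} (P Q : Poly K n) → TotalDegreeAtMost K P d₁ → TotalDegreeAtMost K Q d₂ →
              TotalDegreeAtMost K (P *ₚ Q) (d₁ ℕ.+ d₂)
  degree-*ₚ []      Q []          Q≤d = []
  degree-*ₚ (t ∷ P) Q (t≤d ∷ P≤d) Q≤d = AllP.++⁺ (degree-*ₜ t Q t≤d Q≤d) (degree-*ₚ P Q P≤d Q≤d)

  degree-^ₚ : ∀ {n d} (P : Poly K n) k → TotalDegreeAtMost K P d → TotalDegreeAtMost K (P ^ₚ k) (k ℕ.* d)
  degree-^ₚ P zero    P≤d = degree-1ₚ 0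
  degree-^ₚ P (suc k) P≤d = degree-*ₚ P (P ^ₚ k) P≤d (degree-^ₚ P k P≤d)

  degree-indicatorPoly : ∀ {m n d} (Ps : Vec (Poly K n) m) → VAll.All (λ P → TotalDegreeAtMost K P d) Ps →
                         TotalDegreeAtMost K (indicatorPoly Ps) (m ℕ.* ((q ∸ 1) ℕ.* d))
  degree-indicatorPoly []       VAll.[]         = degree-1ₚ 0
  degree-indicatorPoly (P ∷ Ps) (P≤d VAll.∷ Ps≤d) =
    degree-*ₚ (1ₚ List.++ -ₚ (P ^ₚ (q ∸ 1))) (indicatorPoly Ps)
      (AllP.++⁺ (degree-1ₚ _) (degree-negₚ (degree-^ₚ P (q ∸ 1) P≤d))) (degree-indicatorPoly Ps Ps≤d)

module PartialSums {c ℓ r} (K : FiniteField c ℓ (suc (suc r))) where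
  open FiniteField K hiding (zero)
  open FiniteFieldProperties K using (x^[1+n]≈x; module ∑)
  open ∑ using (∑)
  open PowerSums K
  open Polynomials K
  open ListSum semiring
  open SemiringExp semiring using (_^_)
  open SemiringSum semiring using (*-distribʳ-sum)
  open import Data.Product using (_×_)
  open import Relation.Binary.Reasoning.Setoid setoid

  ∑ᵖ : ∀ β → (Vec Carrier β → Carrier) → Carrier
  ∑ᵖ β f = sumL K (List.map f (points K β))

  ∑ᵖ-suc : ∀ β (f : Vec Carrier (suc β) → Carrier) → ∑ᵖ (suc β) f ≈ ∑ (λ a → ∑ᵖ β (λ z → f (a ∷ z)))
  ∑ᵖ-suc β f = begin
    sumᴸ (List.map f (List.map (Vec.map enum) (List.concatMap prefix (List.allFin _))))
      ≡⟨ ≡.cong sumᴸ (ListP.map-∘ {g = f} (List.concatMap prefix (List.allFin _))) ⟨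
    sumᴸ (List.map (f ∘ Vec.map enum) (List.concatMap prefix (List.allFin _)))
      ≈⟨ sumᴸ-map-concatMap (f ∘ Vec.map enum) prefix (List.allFin _) ⟩
    sumᴸ (List.map (λ i → sumᴸ (List.map (f ∘ Vec.map enum) (prefix i))) (List.allFin _))
      ≡⟨ ≡.cong sumᴸ (ListP.map-cong (λ i → ≡.cong sumᴸ (map-prefix i)) (List.allFin _)) ⟩
    sumᴸ (List.map (λ i → ∑ᵖ β (λ z → f (enum i ∷ z))) (List.allFin _))
      ≈⟨ sumᴸ-map-allFin (λ i → ∑ᵖ β (λ z → f (enum i ∷ z))) ⟩
    ∑ (λ a → ∑ᵖ β (λ z → f (a ∷ z)))  ∎
    where
    prefix : Fin (suc (suc r)) → List (Vec (Fin (suc (suc r))) (suc β))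
    prefix i = List.map (i ∷_) (allVecs K β)
    map-prefix : ∀ i → List.map (f ∘ Vec.map enum) (prefix i) ≡ List.map (λ z → f (enum i ∷ z)) (points K β)
    map-prefix i = ≡.trans (≡.sym (ListP.map-∘ {g = f ∘ Vec.map enum} (allVecs K β)))
                           (ListP.map-∘ {g = λ z → f (enum i ∷ z)} (allVecs K β))

  ∑ᵖ-evalMono-∷ : ∀ {β} e (b : Vec ℕ β) → ∑ᵖ (suc β) (evalMono K (e ∷ b)) ≈ powerSum e * ∑ᵖ β (evalMono K b)
  ∑ᵖ-evalMono-∷ {β} e b = begin
    ∑ᵖ (suc β) (evalMono K (e ∷ b))                     ≈⟨ ∑ᵖ-suc β (evalMono K (e ∷ b)) ⟩
    ∑ (λ a → ∑ᵖ β (λ z → pow K a e * evalMono K b z))   ≈⟨ ∑.∑-cong factor ⟩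
    ∑ (λ a → a ^ e * ∑ᵖ β (evalMono K b))               ≈⟨ *-distribʳ-sum _ (λ i → enum i ^ e) ⟨
    powerSum e * ∑ᵖ β (evalMono K b)                    ∎
    where
    factor : ∀ a → ∑ᵖ β (λ z → pow K a e * evalMono K b z) ≈ a ^ e * ∑ᵖ β (evalMono K b)
    factor a = trans (sym (*-distribˡ-sumᴸ-map (pow K a e) (points K β) (evalMono K b)))
                     (*-congʳ (reflexive (pow≡^ a e)))

  ∑ᵖ-evalMono-q-1 : ∀ β → ∑ᵖ β (evalMono K (Vec.replicate β q-1)) ≈ (- 1#) ^ β
  ∑ᵖ-evalMono-q-1 zero    = +-identityʳ 1#
  ∑ᵖ-evalMono-q-1 (suc β) = trans (∑ᵖ-evalMono-∷ q-1 (Vec.replicate β q-1)) (*-cong powerSum-q-1 (∑ᵖ-evalMono-q-1 β))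

  ∑ᵖ-evalMono-≢ : ∀ {β} (b : Vec ℕ β) → VAll.All (_≤ q-1) b → b ≢ Vec.replicate β q-1 → ∑ᵖ β (evalMono K b) ≈ 0#
  ∑ᵖ-evalMono-≢ []      _                 b≢ = ⊥-elim (b≢ ≡.refl)
  ∑ᵖ-evalMono-≢ (e ∷ b) (e≤q-1 VAll.∷ b≤q-1) b≢ with e ℕ.≟ q-1
  ... | yes ≡.refl = trans (∑ᵖ-evalMono-∷ e b) (trans (*-congˡ (∑ᵖ-evalMono-≢ b b≤q-1 (b≢ ∘ ≡.cong (q-1 ∷_)))) (zeroʳ _))
  ... | no  e≢q-1  = trans (∑ᵖ-evalMono-∷ e b) (trans (*-congʳ (powerSum-< (ℕP.≤∧≢⇒< e≤q-1 e≢q-1))) (zeroˡ _))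

  ReducedWithin : ∀ {n} → ℕ → Vec ℕ n → Set
  ReducedWithin D e = VAll.All (_≤ q-1) e × mdeg K e ≤ D

  reduce : ∀ {n} → Poly K n → Poly K n
  reduce = List.map (λ (a , e) → (a , Vec.map (reduceExp q-1) e))

  evalMono-reduce : ∀ {n} (e : Vec ℕ n) x → evalMono K (Vec.map (reduceExp q-1) e) x ≈ evalMono K e x
  evalMono-reduce []      []       = refl
  evalMono-reduce (a ∷ e) (x ∷ xs) = *-cong pow-reduceExp (evalMono-reduce e xs)
    where
    pow-reduceExp : pow K x (reduceExp q-1 a) ≈ pow K x a
    pow-reduceExp rewrite pow≡^ x (reduceExp q-1 a) | pow≡^ x a = ^-reduceExp semiring (x^[1+n]≈x x) a

  eval-reduce : ∀ {n} (P : Poly K n) x → eval K (reduce P) x ≈ eval K P x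
  eval-reduce []            x = refl
  eval-reduce ((a , e) ∷ P) x = +-cong (*-congˡ (evalMono-reduce e x)) (eval-reduce P x)

  mdeg-map-reduceExp : ∀ {n} (e : Vec ℕ n) → mdeg K (Vec.map (reduceExp q-1) e) ≤ mdeg K e
  mdeg-map-reduceExp []      = z≤n
  mdeg-map-reduceExp (a ∷ e) = ℕP.+-mono-≤ (reduceExp≤ q-1 a) (mdeg-map-reduceExp e)

  mdeg≤n*q-1 : ∀ {n} {e : Vec ℕ n} → VAll.All (_≤ q-1) e → mdeg K e ≤ n ℕ.* q-1
  mdeg≤n*q-1 VAll.[]           = z≤n
  mdeg≤n*q-1 (a≤q-1 VAll.∷ e≤) = ℕP.+-mono-≤ a≤q-1 (mdeg≤n*q-1 e≤)

  map-reduceExp≤q-1 : ∀ {n} (e : Vec ℕ n) → VAll.All (_≤ q-1) (Vec.map (reduceExp q-1) e)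
  map-reduceExp≤q-1 e = VAllP.map⁺ (VAll.universal (reduceExp≤n q-1) e)

  reduce-reduced : ∀ {n} (P : Poly K n) → All (VAll.All (_≤ q-1) ∘ proj₂) (reduce P)
  reduce-reduced P = AllP.map⁺ (AllAll.universal (map-reduceExp≤q-1 ∘ proj₂) P)

  reduce-reducedWithin : ∀ {n D} (P : Poly K n) → TotalDegreeAtMost K P D →
                         All (ReducedWithin (D ℕ.⊓ (n ℕ.* q-1)) ∘ proj₂) (reduce P)
  reduce-reducedWithin []            []          = []
  reduce-reducedWithin ((a , e) ∷ P) (e≤D ∷ P≤D) =
    (map-reduceExp≤q-1 e , ℕP.⊓-glb (ℕP.≤-trans (mdeg-map-reduceExp e) e≤D) (mdeg≤n*q-1 (map-reduceExp≤q-1 e)))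
    ∷ reduce-reducedWithin P P≤D

  infix 4 _≟ⱽ_
  _≟ⱽ_ : ∀ {n} → Decidable {A = Vec ℕ n} _≡_
  _≟ⱽ_ = VecP.≡-dec ℕ._≟_

  module _ (k β : ℕ) where

    -- Σ_z z^b vanishes unless every bⱼ = q - 1, when it is (-1)^β; only those terms survive.
    sumOut : Poly K (k ℕ.+ β) → Poly K k
    sumOut []            = []
    sumOut ((a , e) ∷ P) with Vec.drop k e ≟ⱽ Vec.replicate β q-1
    ... | yes _ = ((- 1#) ^ β * a , Vec.take k e) ∷ sumOut P
    ... | no  _ = sumOut P

    ∑ᵖ-term-factor : ∀ a e Y → ∑ᵖ β (λ z → a * evalMono K e (Y Vec.++ z)) ≈
                        a * evalMono K (Vec.take k e) Y * ∑ᵖ β (evalMono K (Vec.drop k e))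
    ∑ᵖ-term-factor a e Y = begin
      ∑ᵖ β (λ z → a * evalMono K e (Y Vec.++ z))
        ≈⟨ sumᴸ-map-cong (points K β) (λ z → trans (*-congˡ (split z)) (sym (*-assoc _ _ _))) ⟩
      ∑ᵖ β (λ z → a * evalMono K (Vec.take k e) Y * evalMono K (Vec.drop k e) z)
        ≈⟨ *-distribˡ-sumᴸ-map _ (points K β) (evalMono K (Vec.drop k e)) ⟨
      a * evalMono K (Vec.take k e) Y * ∑ᵖ β (evalMono K (Vec.drop k e)) ∎
      where
      split : ∀ z → evalMono K e (Y Vec.++ z) ≈ evalMono K (Vec.take k e) Y * evalMono K (Vec.drop k e) z
      split z = ≡.subst (λ e′ → evalMono K e′ (Y Vec.++ z) ≈ evalMono K (Vec.take k e) Y * evalMono K (Vec.drop k e) z)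
                        (VecP.take++drop≡id k e)
                        (evalMono-++ (Vec.take k e) (Vec.drop k e) Y z)

    ∑ᵖ-term-top : ∀ a e Y → Vec.drop k e ≡ Vec.replicate β q-1 →
                  ∑ᵖ β (λ z → a * evalMono K e (Y Vec.++ z)) ≈ (- 1#) ^ β * a * evalMono K (Vec.take k e) Y
    ∑ᵖ-term-top a e Y e-top = begin
      ∑ᵖ β (λ z → a * evalMono K e (Y Vec.++ z))
        ≈⟨ ∑ᵖ-term-factor a e Y ⟩
      a * evalMono K (Vec.take k e) Y * ∑ᵖ β (evalMono K (Vec.drop k e))
        ≡⟨ ≡.cong (λ b → a * evalMono K (Vec.take k e) Y * ∑ᵖ β (evalMono K b)) e-top ⟩
      a * evalMono K (Vec.take k e) Y * ∑ᵖ β (evalMono K (Vec.replicate β q-1))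
        ≈⟨ *-congˡ (∑ᵖ-evalMono-q-1 β) ⟩
      a * evalMono K (Vec.take k e) Y * (- 1#) ^ β
        ≈⟨ trans (*-comm _ _) (sym (*-assoc _ _ _)) ⟩
      (- 1#) ^ β * a * evalMono K (Vec.take k e) Y ∎

    ∑ᵖ-term-≢ : ∀ a e Y → VAll.All (_≤ q-1) e → Vec.drop k e ≢ Vec.replicate β q-1 →
                ∑ᵖ β (λ z → a * evalMono K e (Y Vec.++ z)) ≈ 0#
    ∑ᵖ-term-≢ a e Y e≤q-1 e-not-top =
      trans (∑ᵖ-term-factor a e Y) (trans (*-congˡ (∑ᵖ-evalMono-≢ _ drop≤q-1 e-not-top)) (zeroʳ _))
      where
      drop≤q-1 : VAll.All (_≤ q-1) (Vec.drop k e)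
      drop≤q-1 = proj₂ (VAllP.++⁻ (Vec.take k e) (≡.subst (VAll.All (_≤ q-1)) (≡.sym (VecP.take++drop≡id k e)) e≤q-1))

    eval-sumOut : ∀ (G : Poly K (k ℕ.+ β)) → All (VAll.All (_≤ q-1) ∘ proj₂) G → ∀ Y →
                  eval K (sumOut G) Y ≈ ∑ᵖ β (λ z → eval K G (Y Vec.++ z))
    eval-sumOut []            []              Y = sym (sumᴸ-map-0# (points K β))
    eval-sumOut ((a , e) ∷ G) (e≤q-1 ∷ G≤q-1) Y with Vec.drop k e ≟ⱽ Vec.replicate β q-1
    ... | yes e-top = begin
      (- 1#) ^ β * a * evalMono K (Vec.take k e) Y + eval K (sumOut G) Y
        ≈⟨ +-cong (sym (∑ᵖ-term-top a e Y e-top)) (eval-sumOut G G≤q-1 Y) ⟩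
      ∑ᵖ β (λ z → a * evalMono K e (Y Vec.++ z)) + ∑ᵖ β (λ z → eval K G (Y Vec.++ z))
        ≈⟨ sumᴸ-map-+ (points K β) _ _ ⟨
      ∑ᵖ β (λ z → eval K ((a , e) ∷ G) (Y Vec.++ z)) ∎
    ... | no e-not-top = begin
      eval K (sumOut G) Y
        ≈⟨ eval-sumOut G G≤q-1 Y ⟩
      ∑ᵖ β (λ z → eval K G (Y Vec.++ z))
        ≈⟨ trans (+-congʳ (∑ᵖ-term-≢ a e Y e≤q-1 e-not-top)) (+-identityˡ _) ⟨
      ∑ᵖ β (λ z → a * evalMono K e (Y Vec.++ z)) + ∑ᵖ β (λ z → eval K G (Y Vec.++ z))
        ≈⟨ sumᴸ-map-+ (points K β) _ _ ⟨
      ∑ᵖ β (λ z → eval K ((a , e) ∷ G) (Y Vec.++ z)) ∎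

    sumOut-exponents : ∀ {p} {Q : Vec ℕ (k ℕ.+ β) → Set p} (G : Poly K (k ℕ.+ β)) → All (Q ∘ proj₂) G →
                       All (λ t → Q (proj₂ t Vec.++ Vec.replicate β q-1)) (sumOut G)
    sumOut-exponents []            []          = []
    sumOut-exponents {Q = Q} ((a , e) ∷ G) (Qe ∷ QG) with Vec.drop k e ≟ⱽ Vec.replicate β q-1
    ... | yes e-top = ≡.subst Q (≡.trans (≡.sym (VecP.take++drop≡id k e)) (≡.cong (Vec.take k e Vec.++_) e-top)) Qe
                      ∷ sumOut-exponents G QG
    ... | no  _     = sumOut-exponents G QG

  partialSumPoly : ∀ {m} k β → Vec (Poly K (k ℕ.+ β)) m → Poly K k
  partialSumPoly k β Ps = sumOut k β (reduce (indicatorPoly Ps))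

  eval-partialSumPoly : ∀ {m} k β (Ps : Vec (Poly K (k ℕ.+ β)) m) Y →
                        eval K (partialSumPoly k β Ps) Y ≈ ∑ᵖ β (λ z → indicator K Ps (Y Vec.++ z))
  eval-partialSumPoly k β Ps Y = trans (eval-sumOut k β _ (reduce-reduced (indicatorPoly Ps)) Y)
    (sumᴸ-map-cong (points K β) (λ z → trans (eval-reduce (indicatorPoly Ps) _) (eval-indicatorPoly Ps _)))

  partialSumPoly-degree : ∀ {m d} k β (Ps : Vec (Poly K (k ℕ.+ β)) m) → VAll.All (λ P → TotalDegreeAtMost K P d) Ps →
    ReducedOfDegreeAtMost K (partialSumPoly k β Ps) ((+ ((m ℕ.* d) ℕ.⊓ (k ℕ.+ β)) ℤ.- + β) ℤ.* + q-1)
  partialSumPoly-degree {m} {d} k β Ps Ps≤d =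
    AllAll.map (λ {t} → bound t) (sumOut-exponents k β {Q = ReducedWithin D} _ (reduce-reducedWithin (indicatorPoly Ps) F≤D))
    where
    M D : ℕ
    M = (m ℕ.* d) ℕ.⊓ (k ℕ.+ β)
    D = m ℕ.* d ℕ.* q-1 ℕ.⊓ ((k ℕ.+ β) ℕ.* q-1)
    F≤D : TotalDegreeAtMost K (indicatorPoly Ps) (m ℕ.* d ℕ.* q-1)
    F≤D = ≡.subst (TotalDegreeAtMost K (indicatorPoly Ps))
            (≡.trans (≡.cong (m ℕ.*_) (ℕP.*-comm q-1 d)) (≡.sym (ℕP.*-assoc m d q-1)))
            (degree-indicatorPoly Ps Ps≤d)
    bound : ∀ (t : Term k) → ReducedWithin D (proj₂ t Vec.++ Vec.replicate β q-1) →
            VAll.All (_≤ q-1) (proj₂ t) × (+ mdeg K (proj₂ t) ℤ.≤ (+ M ℤ.- + β) ℤ.* + q-1)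
    bound t (e++≤q-1 , e++≤D) =
      proj₁ (VAllP.++⁻ (proj₂ t) e++≤q-1) ,
      a+n*o≤m*o⇒+a≤[m-n]*o {m = M} {n = β} q-1 (≡.subst₂ _≤_ (mdeg-++-replicate (proj₂ t) β q-1)
                                              (≡.sym (ℕP.*-distribʳ-⊓ q-1 (m ℕ.* d) (k ℕ.+ β))) e++≤D)

  partialSum-reducedPolynomial : ∀ {m n} d (Ps : Vec (Poly K n) m) → VAll.All (λ P → TotalDegreeAtMost K P d) Ps →
    ∀ k β (k+β≡n : k ℕ.+ β ≡ n) → Σ (Poly K k) λ Z →
      ReducedOfDegreeAtMost K Z ((+ ((m ℕ.* d) ℕ.⊓ n) ℤ.- + β) ℤ.* + q-1) ×
      (∀ Y → eval K Z Y ≈ ∑ᵖ β (λ z → indicator K Ps (≡.subst (Vec Carrier) k+β≡n (Y Vec.++ z))))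
  partialSum-reducedPolynomial d Ps Ps≤d k β ≡.refl =
    partialSumPoly k β Ps , partialSumPoly-degree k β Ps Ps≤d , eval-partialSumPoly k β Ps

noFiniteField₀ : ∀ {c ℓ} → ¬ FiniteField c ℓ 0
noFiniteField₀ K with FiniteField.enum-surjective K (FiniteField.0# K)
... | () , _

noFiniteField₁ : ∀ {c ℓ} → ¬ FiniteField c ℓ 1
noFiniteField₁ K = 1≈0 (enum-surjective 1#) (enum-surjective 0#)
  where
  open FiniteField K
  1≈0 : Σ (Fin 1) (λ i → enum i ≈ 1#) → Σ (Fin 1) (λ i → enum i ≈ 0#) → ⊥
  1≈0 (zero , e₀≈1) (zero , e₀≈0) = 1≉0 (trans (sym e₀≈1) e₀≈0)

open import Data.Nat using (_*_; _⊓_)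
open import Data.Product using (_×_)

lemma3p5 : ∀ {c ℓ : Level} (q : ℕ) → IsPrimePower q → (K : FiniteField c ℓ q) →
    (m n d : ℕ) (Ps : Vec (Poly K n) m) → VAll.All (λ P → TotalDegreeAtMost K P d) Ps →
    (β : ℕ) (β≤n : β ≤ n) →
    Σ (Poly K (n ∸ β)) λ Z →
      ReducedOfDegreeAtMost K Z ((+ ((m * d) ⊓ n) ℤ.- + β) ℤ.* + (q ∸ 1)) ×
      (∀ Y → FiniteField._≈_ K (eval K Z Y) (partialSum K Ps β β≤n Y))
lemma3p5 zero          _ K = ⊥-elim (noFiniteField₀ K)
lemma3p5 (suc zero)    _ K = ⊥-elim (noFiniteField₁ K)
lemma3p5 (suc (suc r)) _ K m n d Ps Ps≤d β β≤n =
  PartialSums.partialSum-reducedPolynomial K d Ps Ps≤d (n ∸ β) β (ℕP.m∸n+n≡m β≤n)
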